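{- For integers $m\ge 1$ and $h\ge 3$, $\chi_{la}(Sp(5,\,2m+1,\,2h+1))=4$.
   Context: All graphs are finite, simple and connected. For a graph $G=(V,E)$ with $q=|E|$ edges, a local antimagic labeling of $G$ is a bijection $f:E\to\{1,\dots,q\}$ such that $f^+(x)\ne f^+(y)$ for every pair of adjacent vertices $x,y$, where $f^+(x)=\sum_{e\ni x} f(e)$. The local antimagic chromatic number $\chi_{la}(G)$ is the minimum, over all local antimagic labelings $f$ of $G$, of the number of distinct values taken by $f^+$. For integers $y_1,y_2,y_3\ge 1$, the spider $Sp(y_1,y_2,y_3)$ is the tree obtained from three paths of lengths (numbers of edges) $y_1,y_2,y_3$ by identifying one end-vertex of each path into a single vertex (the core). -}

module Defs where

open import Data.Nat using (ℕ; zero; suc; _+_; _≤_; _≟_)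
open import Data.Bool using (Bool; if_then_else_; _∨_)
open import Data.Nat.ListAction using (sum)
open import Data.Fin using (Fin; toℕ)
open import Data.List using (List; []; _∷_; _++_; length; lookup; map; upTo; allFin; deduplicate)
open import Data.Product using (_×_; _,_; ∃)
open import Relation.Nullary using (¬_)
open import Relation.Nullary.Decidable using (⌊_⌋)
open import Relation.Binary.PropositionalEquality using (_≡_)
open import Function.Bundles using (_⤖_; Bijection)

-- A finite simple graph given by its vertex set {0,…,nV-1} and its list of edges
-- (each edge an unordered pair of endpoints).  q = length edges.
record Graph : Set where
  field
    nV    : ℕ
    edges : List (ℕ × ℕ)

open Graph public

size : Graph → ℕ
size G = length (edges G)

Labeling : Graph → Set
Labeling G = Fin (size G) ⤖ Fin (size G)

label : (G : Graph) → Labeling G → Fin (size G) → ℕ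
label G π e = suc (toℕ (Bijection.to π e))

incident : ℕ → ℕ × ℕ → Bool
incident v (a , b) = ⌊ v ≟ a ⌋ ∨ ⌊ v ≟ b ⌋

vsum : (G : Graph) → Labeling G → ℕ → ℕ
vsum G π v = sum (map (λ e → if incident v (lookup (edges G) e) then label G π e else 0)
                      (allFin (size G)))

LocalAntimagic : (G : Graph) → Labeling G → Set
LocalAntimagic G π = ∀ e → let (a , b) = lookup (edges G) e in ¬ (vsum G π a ≡ vsum G π b)

numColors : (G : Graph) → Labeling G → ℕ
numColors G π = length (deduplicate _≟_ (map (vsum G π) (upTo (nV G))))

ChiLa : Graph → ℕ → Set
ChiLa G k = (∃ λ π → LocalAntimagic G π × numColors G π ≡ k)
          × (∀ π → LocalAntimagic G π → k ≤ numColors G π)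

pathFrom : ℕ → ℕ → ℕ → List (ℕ × ℕ)
pathFrom prev next zero = []
pathFrom prev next (suc k) = (prev , next) ∷ pathFrom next (suc next) k

leg : ℕ → ℕ → List (ℕ × ℕ)
leg o y = pathFrom 0 (suc o) y

-- spider Sp(y1,y2,y3): core 0, legs on vertices 1..y1, y1+1..y1+y2, y1+y2+1..y1+y2+y3
Sp : ℕ → ℕ → ℕ → Graph
Sp y1 y2 y3 = record
  { nV = suc (y1 + y2 + y3)
  ; edges = leg 0 y1 ++ leg y1 y2 ++ leg (y1 + y2) y3 }

-- Lower bound: in any labelling of a spider whose legs have length at least 2 the
-- three leaves get the (distinct) labels of their pendant edges, and the edge with
-- the largest label q has an endpoint of degree two, whose vertex sum exceeds q.
-- Upper bound, with q = 2m + 2h + 7: label the leg of length 5 from the core by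
-- m+h+3, m+h+4, q-2, 1, q-1, the leg of length 2m+1 by the zigzag
-- 2m+h+4, h+3, 2m+h+3, h+4, ... followed by q, and the leg of length 2h+1 by the
-- zigzag h+2, 2m+h+5, h+1, 2m+h+6, ..., 2.  Consecutive labels of a zigzag sum
-- alternately to q and q-1, so the vertex sums are q, q-1, 3m+3h+9 and 2, and
-- adjacent vertices never share one.

module Submission where

open import Defs
open import Data.Nat using (ℕ; _≤_; _+_; _*_; suc)
open import Data.Nat using (zero; _∸_; _<_; z≤n; s≤s; _≟_; _<?_; _≤?_)
open import Data.Nat.Properties
open import Data.Nat.ListAction using (sum)
open import Data.Nat.Tactic.RingSolver using (solve; solve-∀)
open import Data.Bool using (if_then_else_; _∨_)
open import Data.Empty using (⊥; ⊥-elim)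
open import Data.Fin as Fin using (Fin; toℕ; fromℕ<; punchOut)
open import Data.Fin.Properties using (any?; punchOut-injective; injective⇒≤; toℕ-fromℕ<; toℕ<n; toℕ-injective)
open import Data.List using (List; []; _∷_; _++_; length; lookup; map; tabulate; applyUpTo; upTo; deduplicate)
open import Data.List.Properties using (length-removeAt′; ++-assoc; lookup-applyUpTo; length-applyUpTo)
open import Data.List.Membership.Propositional using (_∈_; _─_)
open import Data.List.Membership.Propositional.Properties
  using (∈-deduplicate⁺; ∈-deduplicate⁻; ∈-map⁺; ∈-map⁻; ∈-upTo⁺; ∈-upTo⁻)
open import Data.List.Relation.Binary.Subset.Propositional using (_⊆_)
import Data.List.Relation.Unary.All as All
import Data.List.Relation.Unary.AllPairs as AllPairs
open import Data.List.Relation.Unary.Any using (here; there; index)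
open import Data.List.Relation.Unary.Unique.Propositional using (Unique)
open import Data.List.Relation.Unary.Unique.DecPropositional.Properties using (deduplicate-!)
open import Data.Product using (_×_; _,_; ∃; proj₁; proj₂)
open import Data.Sum using (_⊎_; inj₁; inj₂)
open import Function.Base using (_∘_)
open import Function.Bundles using (Bijection; mk⤖)
open import Function.Definitions using (Injective)
open import Relation.Binary.Definitions using (DecidableEquality)
open import Relation.Binary.PropositionalEquality
open import Relation.Nullary using (Dec; yes; no; ¬_; contradiction)
open import Relation.Nullary.Decidable using (⌊_⌋; _⊎-dec_)
open import Algebra.Properties.CommutativeSemigroup +-commutativeSemigroup using (interchange)

open ≡-Reasoning

module _ {A : Set} where

  open AllPairs using ([]; _∷_)

  ∈-─ : ∀ {x y : A} {zs} (p : x ∈ zs) → y ∈ zs → x ≢ y → y ∈ zs ─ p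
  ∈-─ (here refl) (here refl) x≢y = ⊥-elim (x≢y refl)
  ∈-─ (here _)    (there q)   _   = q
  ∈-─ (there _)   (here e)    _   = here e
  ∈-─ (there p)   (there q)   x≢y = there (∈-─ p q x≢y)

  Unique-⊆⇒length≤ : ∀ {ys zs : List A} → Unique ys → ys ⊆ zs → length ys ≤ length zs
  Unique-⊆⇒length≤ {[]}     []          _    = z≤n
  Unique-⊆⇒length≤ {y ∷ ys} {zs} (y∉ ∷ u) ys⊆zs =
    subst (suc (length ys) ≤_) (sym (length-removeAt′ zs (index y∈zs)))
      (s≤s (Unique-⊆⇒length≤ u (λ z∈ys → ∈-─ y∈zs (ys⊆zs (there z∈ys)) (All.lookup y∉ z∈ys))))
    where
    y∈zs : y ∈ zs
    y∈zs = ys⊆zs (here refl)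

  module _ (_≟_ : DecidableEquality A) where

    Unique-⊆⇒length≤-deduplicate : ∀ {ys xs : List A} → Unique ys → ys ⊆ xs →
                                   length ys ≤ length (deduplicate _≟_ xs)
    Unique-⊆⇒length≤-deduplicate u ys⊆xs = Unique-⊆⇒length≤ u (∈-deduplicate⁺ _≟_ ∘ ys⊆xs)

    length-deduplicate≤ : ∀ {xs cs : List A} → xs ⊆ cs → length (deduplicate _≟_ xs) ≤ length cs
    length-deduplicate≤ {xs} xs⊆cs =
      Unique-⊆⇒length≤ (deduplicate-! _≟_ xs) (xs⊆cs ∘ ∈-deduplicate⁻ _≟_ xs)

injective⇒surjective : ∀ {n} (f : Fin n → Fin n) → Injective _≡_ _≡_ f → ∀ y → ∃ λ x → f x ≡ y
injective⇒surjective {suc n} f f-inj y with any? (λ x → f x Fin.≟ y)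
... | yes hit = hit
... | no miss = contradiction (injective⇒≤ g-inj) (n≮n n)
  where
  f≢y : ∀ x → f x ≢ y
  f≢y x fx≡y = miss (x , fx≡y)
  g : Fin (suc n) → Fin n
  g x = punchOut (f≢y x ∘ sym)
  g-inj : Injective _≡_ _≡_ g
  g-inj eq = f-inj (punchOut-injective (f≢y _ ∘ sym) (f≢y _ ∘ sym) eq)

surjective⇒injective : ∀ {n} (f : Fin n → Fin n) → (∀ y → ∃ λ x → f x ≡ y) → Injective _≡_ _≡_ f
surjective⇒injective f f-surj {x} {x′} fx≡fx′ = begin
  x           ≡⟨ g∘f x ⟨
  g (f x)     ≡⟨ cong g fx≡fx′ ⟩
  g (f x′)    ≡⟨ g∘f x′ ⟩
  x′          ∎
  where
  g : Fin _ → Fin _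
  g y = proj₁ (f-surj y)
  f∘g : ∀ y → f (g y) ≡ y
  f∘g y = proj₂ (f-surj y)
  g∘f : ∀ x → g (f x) ≡ x
  g∘f x with z , gz≡x ← injective⇒surjective g (λ {y} {y′} e → trans (sym (f∘g y)) (trans (cong f e) (f∘g y′))) x
    = trans (cong g (cong f (sym gz≡x))) (trans (cong g (f∘g z)) gz≡x)

∑< : ℕ → (ℕ → ℕ) → ℕ
∑< zero    f = 0
∑< (suc n) f = f 0 + ∑< n (f ∘ suc)

syntax ∑< n (λ k → t) = ∑[ k < n ] t

∑<-cong : ∀ n {f g : ℕ → ℕ} → (∀ k → k < n → f k ≡ g k) → ∑< n f ≡ ∑< n g
∑<-cong zero    f≗g = refl
∑<-cong (suc n) f≗g = cong₂ _+_ (f≗g 0 (s≤s z≤n)) (∑<-cong n (λ k k<n → f≗g (suc k) (s≤s k<n)))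

∑<-distrib-+ : ∀ n (f g : ℕ → ℕ) → ∑[ k < n ] (f k + g k) ≡ ∑< n f + ∑< n g
∑<-distrib-+ zero    f g = refl
∑<-distrib-+ (suc n) f g =
  trans (cong (f 0 + g 0 +_) (∑<-distrib-+ n (f ∘ suc) (g ∘ suc))) (interchange (f 0) (g 0) _ _)

∑<-zero : ∀ n {f : ℕ → ℕ} → (∀ k → k < n → f k ≡ 0) → ∑< n f ≡ 0
∑<-zero n f≗0 = trans (∑<-cong n f≗0) (∑<-const0 n)
  where
  ∑<-const0 : ∀ n → ∑[ k < n ] 0 ≡ 0
  ∑<-const0 zero    = refl
  ∑<-const0 (suc n) = ∑<-const0 n

∑<-single : ∀ n a {f : ℕ → ℕ} → (∀ k → k < n → k ≢ a → f k ≡ 0) → (n ≤ a → f a ≡ 0) → ∑< n f ≡ f a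
∑<-single zero    a       _    outside = sym (outside z≤n)
∑<-single (suc n) zero    only _       =
  trans (cong (_ +_) (∑<-zero n (λ k k<n → only (suc k) (s≤s k<n) λ ()))) (+-identityʳ _)
∑<-single (suc n) (suc a) {f} only outside =
  trans (cong (_+ ∑< n (f ∘ suc)) (only 0 (s≤s z≤n) λ ()))
        (∑<-single n a (λ k k<n k≢a → only (suc k) (s≤s k<n) (k≢a ∘ suc-injective))
                       (outside ∘ s≤s))

extend₀ : ∀ {n} → (Fin n → ℕ) → ℕ → ℕ
extend₀ {zero}  f k       = 0
extend₀ {suc n} f zero    = f Fin.zero
extend₀ {suc n} f (suc k) = extend₀ (f ∘ Fin.suc) k

extend₀-toℕ : ∀ {n} (f : Fin n → ℕ) i → extend₀ f (toℕ i) ≡ f i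
extend₀-toℕ f Fin.zero    = refl
extend₀-toℕ f (Fin.suc i) = extend₀-toℕ (f ∘ Fin.suc) i

extend₀-fromℕ< : ∀ {n} (f : Fin n → ℕ) {k} (k<n : k < n) → extend₀ f k ≡ f (fromℕ< k<n)
extend₀-fromℕ< f k<n = trans (cong (extend₀ f) (sym (toℕ-fromℕ< k<n))) (extend₀-toℕ f _)

extend₀-≥ : ∀ {n} (f : Fin n → ℕ) k → n ≤ k → extend₀ f k ≡ 0
extend₀-≥ {zero}  f k       _         = refl
extend₀-≥ {suc n} f (suc k) (s≤s n≤k) = extend₀-≥ (f ∘ Fin.suc) k n≤k

extend₀-≗ : ∀ {n} {f : Fin n → ℕ} {g : ℕ → ℕ} → (∀ i → f i ≡ g (toℕ i)) →
            ∀ k → k < n → extend₀ f k ≡ g k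
extend₀-≗ {f = f} {g} f≗g k k<n = trans (extend₀-fromℕ< f k<n) (trans (f≗g _) (cong g (toℕ-fromℕ< k<n)))

sum-map-tabulate : ∀ {A : Set} {n} (f : A → ℕ) (g : Fin n → A) → sum (map f (tabulate g)) ≡ ∑< n (extend₀ (f ∘ g))
sum-map-tabulate {n = zero}  f g = refl
sum-map-tabulate {n = suc n} f g = cong (f (g Fin.zero) +_) (sum-map-tabulate f (g ∘ Fin.suc))

module _ (G : Graph) (π : Labeling G) where

  edgeLabel : ℕ → ℕ
  edgeLabel = extend₀ (label G π)

  vsum-∑ : (E : ℕ → ℕ × ℕ) → (∀ e → lookup (edges G) e ≡ E (toℕ e)) → ∀ v →
           vsum G π v ≡ ∑[ k < size G ] (if incident v (E k) then edgeLabel k else 0)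
  vsum-∑ E edge≡E v =
    trans (sum-map-tabulate (λ e → if incident v (lookup (edges G) e) then label G π e else 0) (λ e → e))
          (∑<-cong (size G) (extend₀-≗ λ e → cong₂ (λ uv ℓ → if incident v uv then ℓ else 0)
                                                   (edge≡E e) (sym (extend₀-toℕ (label G π) e))))

  private
    ℓ = edgeLabel
    Q = size G

  edgeLabel-< : ∀ {k} (k<Q : k < Q) → edgeLabel k ≡ suc (toℕ (Bijection.to π (fromℕ< k<Q)))
  edgeLabel-< = extend₀-fromℕ< (label G π)

  edgeLabel-positive : ∀ {k} → k < Q → 0 < ℓ k
  edgeLabel-positive k<Q rewrite edgeLabel-< k<Q = s≤s z≤n

  edgeLabel-≤ : ∀ k → ℓ k ≤ Q
  edgeLabel-≤ k with k <? Q
  ... | yes k<Q rewrite edgeLabel-< k<Q = toℕ<n _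
  ... | no  k≮Q rewrite extend₀-≥ (label G π) k (≮⇒≥ k≮Q) = z≤n

  edgeLabel-injective : ∀ {k k′} → k < Q → k′ < Q → ℓ k ≡ ℓ k′ → k ≡ k′
  edgeLabel-injective k<Q k′<Q ℓk≡ℓk′ rewrite edgeLabel-< k<Q | edgeLabel-< k′<Q =
    trans (sym (toℕ-fromℕ< k<Q))
          (trans (cong toℕ (Bijection.injective π (toℕ-injective (suc-injective ℓk≡ℓk′)))) (toℕ-fromℕ< k′<Q))

  edgeLabel-max : ∀ {q} → Q ≡ suc q → ∃ λ k → k < Q × ℓ k ≡ Q
  edgeLabel-max {q} Q≡1+q =
    toℕ x , toℕ<n x ,
    trans (extend₀-toℕ (label G π) x) (trans (cong (suc ∘ toℕ) πx≡q) (trans (cong suc (toℕ-fromℕ< q<Q)) (sym Q≡1+q)))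
    where
    q<Q : q < Q
    q<Q = ≤-reflexive (sym Q≡1+q)
    x : Fin Q
    x = proj₁ (Bijection.strictlySurjective π (fromℕ< q<Q))
    πx≡q = proj₂ (Bijection.strictlySurjective π (fromℕ< q<Q))

  numColors-≥ : ∀ {vs : List ℕ} → Unique vs → (∀ {s} → s ∈ vs → ∃ λ v → v < nV G × vsum G π v ≡ s) →
                length vs ≤ numColors G π
  numColors-≥ u realised = Unique-⊆⇒length≤-deduplicate _≟_ u (λ s∈vs → hit (realised s∈vs))
    where
    hit : ∀ {s} → (∃ λ v → v < nV G × vsum G π v ≡ s) → s ∈ map (vsum G π) (upTo (nV G))
    hit (v , v<n , refl) = ∈-map⁺ (vsum G π) (∈-upTo⁺ v<n)

  numColors-≤ : ∀ (cs : List ℕ) → (∀ v → v < nV G → vsum G π v ∈ cs) → numColors G π ≤ length cs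
  numColors-≤ cs within = length-deduplicate≤ _≟_ λ s∈ → hit (∈-map⁻ (vsum G π) s∈)
    where
    hit : ∀ {s} → (∃ λ v → v ∈ upTo (nV G) × s ≡ vsum G π v) → s ∈ cs
    hit (v , v∈ , refl) = within v (∈-upTo⁻ v∈)

ChiLa-intro : ∀ {G k} → (∃ λ π → LocalAntimagic G π × numColors G π ≤ k) → (∀ π → k ≤ numColors G π) → ChiLa G k
ChiLa-intro (π , antimagic , ≤k) k≤ = (π , antimagic , ≤-antisym ≤k (k≤ π)) , λ π _ → k≤ π

suc[n∸1]≡n : ∀ {n} → 0 < n → suc (n ∸ 1) ≡ n
suc[n∸1]≡n (s≤s _) = refl

module _ (G : Graph) where

  private
    Q = size G

  labeling-from : ∀ {n} → size G ≡ n → (f : ℕ → ℕ) → (∀ k → k < n → 0 < f k × f k ≤ n) →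
                  (∀ x → x < n → ∃ λ k → k < n × f k ≡ suc x) →
                  ∃ λ π → ∀ k → k < n → edgeLabel G π k ≡ f k
  labeling-from refl f inRange onto = π , ℓ≡f
    where
    pred-f< : ∀ k → k < Q → f k ∸ 1 < Q
    pred-f< k k<Q = subst (_≤ Q) (sym (suc[n∸1]≡n (proj₁ (inRange k k<Q)))) (proj₂ (inRange k k<Q))
    to : Fin Q → Fin Q
    to e = fromℕ< (pred-f< (toℕ e) (toℕ<n e))
    suc-toℕ-to : ∀ e → suc (toℕ (to e)) ≡ f (toℕ e)
    suc-toℕ-to e = trans (cong suc (toℕ-fromℕ< _)) (suc[n∸1]≡n (proj₁ (inRange (toℕ e) (toℕ<n e))))
    to-onto : ∀ y → ∃ λ x → to x ≡ y
    to-onto y with k , k<Q , fk≡1+y ← onto (toℕ y) (toℕ<n y) =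
      fromℕ< k<Q , toℕ-injective (suc-injective (trans (suc-toℕ-to (fromℕ< k<Q))
                                                       (trans (cong f (toℕ-fromℕ< k<Q)) fk≡1+y)))
    π : Labeling G
    π = mk⤖ (surjective⇒injective to to-onto , λ y → proj₁ (to-onto y) , λ x≡ → trans (cong to x≡) (proj₂ (to-onto y)))
    ℓ≡f : ∀ k → k < Q → edgeLabel G π k ≡ f k
    ℓ≡f k k<Q = trans (edgeLabel-< G π k<Q) (trans (suc-toℕ-to (fromℕ< k<Q)) (cong f (toℕ-fromℕ< k<Q)))

applyUpTo-cong : ∀ {A : Set} n {f g : ℕ → A} → (∀ i → i < n → f i ≡ g i) → applyUpTo f n ≡ applyUpTo g n
applyUpTo-cong zero    f≗g = refl
applyUpTo-cong (suc n) f≗g = cong₂ _∷_ (f≗g 0 (s≤s z≤n)) (applyUpTo-cong n (λ i i<n → f≗g (suc i) (s≤s i<n)))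

applyUpTo-+ : ∀ {A : Set} (f : ℕ → A) m n → applyUpTo f (m + n) ≡ applyUpTo f m ++ applyUpTo (λ i → f (m + i)) n
applyUpTo-+ f zero    n = refl
applyUpTo-+ f (suc m) n = cong (f 0 ∷_) (applyUpTo-+ (f ∘ suc) m n)

pathFrom-straight : ∀ k y → pathFrom k (suc k) y ≡ applyUpTo (λ j → (j + k , suc (j + k))) y
pathFrom-straight k zero    = refl
pathFrom-straight k (suc y) =
  cong ((k , suc k) ∷_) (trans (pathFrom-straight (suc k) y)
                               (applyUpTo-cong y (λ j _ → cong (λ i → (i , suc i)) (+-suc j k))))

_when_ : ∀ {A : Set} → ℕ → Dec A → ℕ
x when a? = if ⌊ a? ⌋ then x else 0

when-yes : ∀ {A : Set} (a? : Dec A) x → A → x when a? ≡ x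
when-yes (yes _) x _ = refl
when-yes (no ¬a) x a = ⊥-elim (¬a a)

when-no : ∀ {A : Set} (a? : Dec A) x → ¬ A → x when a? ≡ 0
when-no (yes a) x ¬a = ⊥-elim (¬a a)
when-no (no _)  x _  = refl

0-when : ∀ {A : Set} (a? : Dec A) → 0 when a? ≡ 0
0-when (yes _) = refl
0-when (no _)  = refl

when-∨ : ∀ {A B : Set} (a? : Dec A) (b? : Dec B) → (A → B → ⊥) → ∀ x →
         (if ⌊ a? ⌋ ∨ ⌊ b? ⌋ then x else 0) ≡ x when a? + x when b?
when-∨ (yes a) (yes b) ¬ab x = ⊥-elim (¬ab a b)
when-∨ (yes _) (no _)  _   x = sym (+-identityʳ x)
when-∨ (no _)  (yes _) _   x = refl
when-∨ (no _)  (no _)  _   x = refl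

when-⊎ : ∀ {A B : Set} (a? : Dec A) (b? : Dec B) → (A × B → ⊥) → ∀ x →
         x when (a? ⊎-dec b?) ≡ x when a? + x when b?
when-⊎ (yes a) (yes b) ¬ab x = ⊥-elim (¬ab (a , b))
when-⊎ (yes _) (no _)  _   x = sym (+-identityʳ x)
when-⊎ (no _)  (yes _) _   x = refl
when-⊎ (no _)  (no _)  _   x = refl

module Spider (y₁ y₂ y₃ : ℕ) where

  S : Graph
  S = Sp y₁ y₂ y₃

  LegStart : ℕ → Set
  LegStart k = k ≡ 0 ⊎ k ≡ y₁ ⊎ k ≡ y₁ + y₂

  legStart? : ∀ k → Dec (LegStart k)
  legStart? k = k ≟ 0 ⊎-dec k ≟ y₁ ⊎-dec k ≟ y₁ + y₂

  parent : ℕ → ℕ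
  parent k = if ⌊ legStart? k ⌋ then 0 else k

  parent-start : ∀ {k} → LegStart k → parent k ≡ 0
  parent-start {k} s with legStart? k
  ... | yes _ = refl
  ... | no ¬s = ⊥-elim (¬s s)

  parent-inner : ∀ {k} → ¬ LegStart k → parent k ≡ k
  parent-inner {k} ¬s with legStart? k
  ... | yes s = ⊥-elim (¬s s)
  ... | no _  = refl

  parent<suc : ∀ k → parent k < suc k
  parent<suc k with legStart? k
  ... | yes _ = s≤s z≤n
  ... | no _  = ≤-refl

  ¬LegStart : ∀ {k} → 0 < k → k ≢ y₁ → k ≢ y₁ + y₂ → ¬ LegStart k
  ¬LegStart 0<k _    _     (inj₁ k≡0)        = <⇒≢ 0<k (sym k≡0)
  ¬LegStart _   k≢y₁ _     (inj₂ (inj₁ k≡y₁)) = k≢y₁ k≡y₁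
  ¬LegStart _   _    k≢y₁₂ (inj₂ (inj₂ k≡y₁₂)) = k≢y₁₂ k≡y₁₂

  when-0≟parent : 0 < y₁ → 0 < y₂ → ∀ k x →
                  x when (0 ≟ parent k) ≡ x when (k ≟ 0) + x when (k ≟ y₁) + x when (k ≟ y₁ + y₂)
  when-0≟parent 0<y₁ 0<y₂ k x = begin
    x when (0 ≟ parent k)
      ≡⟨ when-root ⟩
    x when (k ≟ 0 ⊎-dec k ≟ y₁ ⊎-dec k ≟ y₁ + y₂)
      ≡⟨ when-⊎ (k ≟ 0) _ disjoint₀ x ⟩
    x when (k ≟ 0) + x when (k ≟ y₁ ⊎-dec k ≟ y₁ + y₂)
      ≡⟨ cong (x when (k ≟ 0) +_) (when-⊎ (k ≟ y₁) (k ≟ y₁ + y₂) disjoint₁ x) ⟩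
    x when (k ≟ 0) + (x when (k ≟ y₁) + x when (k ≟ y₁ + y₂))
      ≡⟨ +-assoc (x when (k ≟ 0)) _ _ ⟨
    x when (k ≟ 0) + x when (k ≟ y₁) + x when (k ≟ y₁ + y₂) ∎
    where
    when-root : x when (0 ≟ parent k) ≡ x when legStart? k
    when-root with legStart? k
    ... | yes _ = refl
    ... | no ¬s = when-no (0 ≟ k) x (¬s ∘ inj₁ ∘ sym)
    disjoint₀ : k ≡ 0 × (k ≡ y₁ ⊎ k ≡ y₁ + y₂) → ⊥
    disjoint₀ (refl , inj₁ 0≡y₁)  = <⇒≢ 0<y₁ 0≡y₁
    disjoint₀ (refl , inj₂ 0≡y₁₂) = <⇒≢ (≤-trans 0<y₁ (m≤m+n y₁ y₂)) 0≡y₁₂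
    disjoint₁ : k ≡ y₁ × k ≡ y₁ + y₂ → ⊥
    disjoint₁ (refl , y₁≡y₁₂) = <⇒≢ (m<m+n y₁ 0<y₂) y₁≡y₁₂

  spiderEdge : ℕ → ℕ × ℕ
  spiderEdge k = (parent k , suc k)

  leg-applyUpTo : ∀ o y → LegStart o → (∀ j → suc j < y → ¬ LegStart (o + suc j)) →
                  leg o y ≡ applyUpTo (λ i → spiderEdge (o + i)) y
  leg-applyUpTo o zero    _ _     = refl
  leg-applyUpTo o (suc y) s inner = cong₂ _∷_ head (trans (pathFrom-straight (suc o) y) (applyUpTo-cong y tail))
    where
    head : (0 , suc o) ≡ spiderEdge (o + 0)
    head rewrite +-identityʳ o = cong (_, suc o) (sym (parent-start s))
    tail : ∀ j → j < y → (j + suc o , suc (j + suc o)) ≡ spiderEdge (o + suc j)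
    tail j j<y rewrite parent-inner (inner j (s≤s j<y)) | +-suc j o | +-comm j o | +-suc o j = refl

  edges-Sp : edges S ≡ applyUpTo spiderEdge (y₁ + y₂ + y₃)
  edges-Sp = sym (begin
    applyUpTo spiderEdge (y₁ + y₂ + y₃)
      ≡⟨ applyUpTo-+ spiderEdge (y₁ + y₂) y₃ ⟩
    applyUpTo spiderEdge (y₁ + y₂) ++ leg₃
      ≡⟨ cong (_++ leg₃) (applyUpTo-+ spiderEdge y₁ y₂) ⟩
    (leg₁ ++ leg₂) ++ leg₃
      ≡⟨ ++-assoc leg₁ leg₂ leg₃ ⟩
    leg₁ ++ leg₂ ++ leg₃
      ≡⟨ cong₃ (λ l₁ l₂ l₃ → l₁ ++ l₂ ++ l₃)
           (sym (leg-applyUpTo 0 y₁ (inj₁ refl) inner₁))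
           (sym (leg-applyUpTo y₁ y₂ (inj₂ (inj₁ refl)) inner₂))
           (sym (leg-applyUpTo (y₁ + y₂) y₃ (inj₂ (inj₂ refl)) inner₃)) ⟩
    leg 0 y₁ ++ leg y₁ y₂ ++ leg (y₁ + y₂) y₃ ∎)
    where
    leg₁ = applyUpTo spiderEdge y₁
    leg₂ = applyUpTo (λ i → spiderEdge (y₁ + i)) y₂
    leg₃ = applyUpTo (λ i → spiderEdge (y₁ + y₂ + i)) y₃
    cong₃ : ∀ {A : Set} (f : A → A → A → A) {a a′ b b′ c c′} →
            a ≡ a′ → b ≡ b′ → c ≡ c′ → f a b c ≡ f a′ b′ c′
    cong₃ f refl refl refl = refl
    inner₁ : ∀ j → suc j < y₁ → ¬ LegStart (suc j)
    inner₁ j j<y₁ = ¬LegStart (s≤s z≤n) (<⇒≢ j<y₁) (<⇒≢ (≤-trans j<y₁ (m≤m+n y₁ y₂)))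
    inner₂ : ∀ j → suc j < y₂ → ¬ LegStart (y₁ + suc j)
    inner₂ j j<y₂ = ¬LegStart (≤-trans (s≤s z≤n) (m≤n+m (suc j) y₁))
                              (>⇒≢ (m<m+n y₁ (s≤s z≤n))) (<⇒≢ (+-monoʳ-< y₁ j<y₂))
    inner₃ : ∀ j → suc j < y₃ → ¬ LegStart (y₁ + y₂ + suc j)
    inner₃ j _ = ¬LegStart (≤-trans (s≤s z≤n) (m≤n+m (suc j) (y₁ + y₂)))
                          (>⇒≢ (≤-<-trans (m≤m+n y₁ y₂) (m<m+n (y₁ + y₂) (s≤s z≤n))))
                          (>⇒≢ (m<m+n (y₁ + y₂) (s≤s z≤n)))

  lookup-edges-Sp : ∀ e → lookup (edges S) e ≡ spiderEdge (toℕ e)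
  lookup-edges-Sp = lookup-≡ edges-Sp
    where
    lookup-≡ : ∀ {xs : List (ℕ × ℕ)} {n} → xs ≡ applyUpTo spiderEdge n → ∀ e → lookup xs e ≡ spiderEdge (toℕ e)
    lookup-≡ {n = n} refl = lookup-applyUpTo spiderEdge n

  size-Sp : size S ≡ y₁ + y₂ + y₃
  size-Sp = trans (cong length edges-Sp) (length-applyUpTo spiderEdge _)

  module VertexSums (π : Labeling S) where

    ℓ : ℕ → ℕ
    ℓ = edgeLabel S π

    Q : ℕ
    Q = size S

    ℓ-≥ : ∀ k → Q ≤ k → ℓ k ≡ 0
    ℓ-≥ = extend₀-≥ (label S π)

    vsum-split : ∀ v → vsum S π v ≡ ∑[ k < Q ] (ℓ k when (v ≟ parent k)) + ∑[ k < Q ] (ℓ k when (v ≟ suc k))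
    vsum-split v =
      trans (vsum-∑ S π spiderEdge lookup-edges-Sp v)
            (trans (∑<-cong Q (λ k _ → when-∨ (v ≟ parent k) (v ≟ suc k)
                                         (λ v≡p v≡s → <⇒≢ (parent<suc k) (trans (sym v≡p) v≡s)) (ℓ k)))
                   (∑<-distrib-+ Q _ _))

    vsum-suc : ∀ i → vsum S π (suc i) ≡ ℓ i + ℓ (suc i) when (suc i ≟ parent (suc i))
    vsum-suc i = begin
      vsum S π (suc i)
        ≡⟨ vsum-split (suc i) ⟩
      ∑[ k < Q ] (ℓ k when (suc i ≟ parent k)) + ∑[ k < Q ] (ℓ k when (suc i ≟ suc k))
        ≡⟨ cong₂ _+_ (∑<-single Q (suc i) children (λ Q≤ → trans (cong (_when _) (ℓ-≥ _ Q≤)) (0-when _)))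
                     (∑<-single Q i (λ k _ k≢i → when-no (suc i ≟ suc k) (ℓ k) (k≢i ∘ sym ∘ suc-injective))
                                    (λ Q≤ → trans (cong (_when _) (ℓ-≥ _ Q≤)) (0-when _))) ⟩
      ℓ (suc i) when (suc i ≟ parent (suc i)) + ℓ i when (suc i ≟ suc i)
        ≡⟨ cong (ℓ (suc i) when (suc i ≟ parent (suc i)) +_) (when-yes (suc i ≟ suc i) (ℓ i) refl) ⟩
      ℓ (suc i) when (suc i ≟ parent (suc i)) + ℓ i
        ≡⟨ +-comm _ (ℓ i) ⟩
      ℓ i + ℓ (suc i) when (suc i ≟ parent (suc i)) ∎
      where
      children : ∀ k → k < Q → k ≢ suc i → ℓ k when (suc i ≟ parent k) ≡ 0
      children k _ k≢1+i with legStart? k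
      ... | yes _ = when-no (suc i ≟ 0) (ℓ k) λ ()
      ... | no _  = when-no (suc i ≟ k) (ℓ k) (k≢1+i ∘ sym)

    vsum-inner : ∀ i → ¬ LegStart (suc i) → vsum S π (suc i) ≡ ℓ i + ℓ (suc i)
    vsum-inner i ¬s = trans (vsum-suc i) (cong (ℓ i +_) (when-yes (suc i ≟ _) _ (sym (parent-inner ¬s))))

    vsum-legEnd : ∀ i → LegStart (suc i) → vsum S π (suc i) ≡ ℓ i
    vsum-legEnd i s =
      trans (vsum-suc i) (trans (cong (ℓ i +_) (when-no (suc i ≟ _) _ (λ e → 1+n≢0 (trans e (parent-start s)))))
                                (+-identityʳ (ℓ i)))

    vsum-last : ∀ i → Q ≡ suc i → vsum S π (suc i) ≡ ℓ i
    vsum-last i Q≡ =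
      trans (vsum-suc i) (trans (cong (λ x → ℓ i + x when (suc i ≟ parent (suc i))) (ℓ-≥ (suc i) (≤-reflexive Q≡)))
                                (trans (cong (ℓ i +_) (0-when _)) (+-identityʳ (ℓ i))))

    ∑-when-≟ : ∀ a → ∑[ k < Q ] (ℓ k when (k ≟ a)) ≡ ℓ a
    ∑-when-≟ a = trans (∑<-single Q a (λ k _ k≢a → when-no (k ≟ a) (ℓ k) k≢a)
                                       (λ Q≤a → trans (cong (_when (a ≟ a)) (ℓ-≥ a Q≤a)) (0-when (a ≟ a))))
                       (when-yes (a ≟ a) (ℓ a) refl)

    vsum-core : 0 < y₁ → 0 < y₂ → vsum S π 0 ≡ ℓ 0 + ℓ y₁ + ℓ (y₁ + y₂)
    vsum-core 0<y₁ 0<y₂ = begin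
      vsum S π 0
        ≡⟨ vsum-split 0 ⟩
      ∑[ k < Q ] (ℓ k when (0 ≟ parent k)) + ∑[ k < Q ] (ℓ k when (0 ≟ suc k))
        ≡⟨ cong₂ _+_ (∑<-cong Q (λ k _ → when-0≟parent 0<y₁ 0<y₂ k (ℓ k)))
                     (∑<-zero Q (λ k _ → when-no (0 ≟ suc k) (ℓ k) λ ())) ⟩
      ∑[ k < Q ] (ℓ k when (k ≟ 0) + ℓ k when (k ≟ y₁) + ℓ k when (k ≟ y₁ + y₂)) + 0
        ≡⟨ +-identityʳ _ ⟩
      ∑[ k < Q ] (ℓ k when (k ≟ 0) + ℓ k when (k ≟ y₁) + ℓ k when (k ≟ y₁ + y₂))
        ≡⟨ ∑<-distrib-+ Q (λ k → ℓ k when (k ≟ 0) + ℓ k when (k ≟ y₁)) (λ k → ℓ k when (k ≟ y₁ + y₂)) ⟩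
      ∑[ k < Q ] (ℓ k when (k ≟ 0) + ℓ k when (k ≟ y₁)) + ∑[ k < Q ] (ℓ k when (k ≟ y₁ + y₂))
        ≡⟨ cong (_+ ∑[ k < Q ] (ℓ k when (k ≟ y₁ + y₂))) (∑<-distrib-+ Q (λ k → ℓ k when (k ≟ 0)) (λ k → ℓ k when (k ≟ y₁))) ⟩
      ∑[ k < Q ] (ℓ k when (k ≟ 0)) + ∑[ k < Q ] (ℓ k when (k ≟ y₁)) + ∑[ k < Q ] (ℓ k when (k ≟ y₁ + y₂))
        ≡⟨ cong₂ _+_ (cong₂ _+_ (∑-when-≟ 0) (∑-when-≟ y₁)) (∑-when-≟ (y₁ + y₂)) ⟩
      ℓ 0 + ℓ y₁ + ℓ (y₁ + y₂) ∎

    localAntimagic : (∀ k → k < Q → vsum S π (parent k) ≢ vsum S π (suc k)) → LocalAntimagic S π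
    localAntimagic adjacent e =
      subst (λ uv → ¬ (vsum S π (proj₁ uv) ≡ vsum S π (proj₂ uv))) (sym (lookup-edges-Sp e)) (adjacent (toℕ e) (toℕ<n e))

1+m<m+n : ∀ m {n} → 2 ≤ n → suc m < m + n
1+m<m+n m {n} 2≤n = subst (suc (suc m) ≤_) (+-comm n m) (+-monoˡ-≤ m 2≤n)

module FourDistinctSums (a y₂ y₃ : ℕ) (2≤y₂ : 2 ≤ y₂) (2≤y₃ : 2 ≤ y₃) (π : Labeling (Sp (suc (suc a)) y₂ y₃)) where

  open Spider (suc (suc a)) y₂ y₃
  open VertexSums π

  k₁ k₂ k₃ : ℕ
  k₁ = suc a
  k₂ = k₁ + y₂
  k₃ = k₂ + y₃

  k₁<k₂ : k₁ < k₂
  k₁<k₂ = m<m+n k₁ (≤-trans (s≤s z≤n) 2≤y₂)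

  k₂<k₃ : k₂ < k₃
  k₂<k₃ = m<m+n k₂ (≤-trans (s≤s z≤n) 2≤y₃)

  k₃<Q : k₃ < Q
  k₃<Q = ≤-reflexive (sym size-Sp)

  k₂<Q : k₂ < Q
  k₂<Q = <-trans k₂<k₃ k₃<Q

  k₁<Q : k₁ < Q
  k₁<Q = <-trans k₁<k₂ k₂<Q

  ¬LegStart-k₁ : ¬ LegStart k₁
  ¬LegStart-k₁ = ¬LegStart (s≤s z≤n) (<⇒≢ (n<1+n k₁)) (<⇒≢ (<-≤-trans (n<1+n k₁) (m≤m+n (suc k₁) y₂)))

  ¬LegStart-k₂ : ¬ LegStart k₂
  ¬LegStart-k₂ = ¬LegStart (s≤s z≤n) (>⇒≢ (1+m<m+n k₁ 2≤y₂)) (<⇒≢ (n<1+n k₂))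

  ¬LegStart-k₃ : ¬ LegStart k₃
  ¬LegStart-k₃ = ¬LegStart (s≤s z≤n) (>⇒≢ (<-trans (1+m<m+n k₁ 2≤y₂) k₂<k₃)) (>⇒≢ (1+m<m+n k₂ 2≤y₃))

  ≤Q⇒<nV : ∀ {v} → v ≤ Q → v < nV S
  ≤Q⇒<nV v≤Q = s≤s (≤-trans v≤Q (≤-reflexive size-Sp))

  HeavyVertex : Set
  HeavyVertex = ∃ λ v → v < nV S × suc Q ≤ vsum S π v

  inner-heavy : ∀ p → ¬ LegStart (suc p) → suc p < Q → ℓ p ≡ Q ⊎ ℓ (suc p) ≡ Q → HeavyVertex
  inner-heavy p ¬s 1+p<Q ℓ≡Q = suc p , ≤Q⇒<nV (<⇒≤ 1+p<Q) , subst (suc Q ≤_) (sym (vsum-inner p ¬s)) (heavy ℓ≡Q)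
    where
    heavy : ℓ p ≡ Q ⊎ ℓ (suc p) ≡ Q → suc Q ≤ ℓ p + ℓ (suc p)
    heavy (inj₁ ℓp≡Q)   rewrite ℓp≡Q   =
      subst (_≤ Q + ℓ (suc p)) (+-comm Q 1) (+-monoʳ-≤ Q (edgeLabel-positive S π 1+p<Q))
    heavy (inj₂ ℓ1+p≡Q) rewrite ℓ1+p≡Q = +-monoˡ-≤ Q (edgeLabel-positive S π (<-trans (n<1+n p) 1+p<Q))

  heavyVertex : HeavyVertex
  heavyVertex with n , n<Q , ℓn≡Q ← edgeLabel-max S π size-Sp | legStart? (suc n) | suc n <? Q
  ... | no ¬s                  | yes 1+n<Q = inner-heavy n ¬s 1+n<Q (inj₁ ℓn≡Q)
  ... | yes (inj₂ (inj₁ refl)) | _         = inner-heavy a ¬LegStart-k₁ k₁<Q (inj₂ ℓn≡Q)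
  ... | yes (inj₂ (inj₂ refl)) | _         = inner-heavy (a + y₂) ¬LegStart-k₂ k₂<Q (inj₂ ℓn≡Q)
  ... | no _                   | no 1+n≮Q  =
    inner-heavy (a + y₂ + y₃) ¬LegStart-k₃ k₃<Q (inj₂ (subst (λ k → ℓ k ≡ Q) n≡k₃ ℓn≡Q))
    where
    n≡k₃ : n ≡ k₃
    n≡k₃ = suc-injective (≤-antisym (≤-trans n<Q (≤-reflexive size-Sp))
                                    (≤-trans (≤-reflexive (sym size-Sp)) (≮⇒≥ 1+n≮Q)))

  ℓ≢heavy : ∀ k → ℓ k ≢ vsum S π (proj₁ heavyVertex)
  ℓ≢heavy k = <⇒≢ (<-≤-trans (s≤s (edgeLabel-≤ S π k)) (proj₂ (proj₂ heavyVertex)))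

  <⇒ℓ≢ : ∀ {k k′} → k < Q → k′ < Q → k < k′ → ℓ k ≢ ℓ k′
  <⇒ℓ≢ k<Q k′<Q k<k′ = <⇒≢ k<k′ ∘ edgeLabel-injective S π k<Q k′<Q

  fourSums-unique : Unique (ℓ k₁ ∷ ℓ k₂ ∷ ℓ k₃ ∷ vsum S π (proj₁ heavyVertex) ∷ [])
  fourSums-unique =
    (<⇒ℓ≢ k₁<Q k₂<Q k₁<k₂ ∷ <⇒ℓ≢ k₁<Q k₃<Q (<-trans k₁<k₂ k₂<k₃) ∷
     ℓ≢heavy k₁ ∷ []) ∷
    (<⇒ℓ≢ k₂<Q k₃<Q k₂<k₃ ∷ ℓ≢heavy k₂ ∷ []) ∷
    (ℓ≢heavy k₃ ∷ []) ∷ [] ∷ []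
    where
    open AllPairs using ([]; _∷_)
    open All using ([]; _∷_)

numColors-Sp≥4 : ∀ {y₁ y₂ y₃} → 2 ≤ y₁ → 2 ≤ y₂ → 2 ≤ y₃ → ∀ π → 4 ≤ numColors (Sp y₁ y₂ y₃) π
numColors-Sp≥4 {suc (suc a)} {y₂} {y₃} (s≤s (s≤s z≤n)) 2≤y₂ 2≤y₃ π = numColors-≥ S π fourSums-unique
  λ { (here refl)                         → suc k₁ , ≤Q⇒<nV k₁<Q , vsum-legEnd k₁ (inj₂ (inj₁ refl))
    ; (there (here refl))                 → suc k₂ , ≤Q⇒<nV k₂<Q , vsum-legEnd k₂ (inj₂ (inj₂ refl))
    ; (there (there (here refl)))         → suc k₃ , ≤Q⇒<nV k₃<Q , vsum-last k₃ size-Sp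
    ; (there (there (there (here refl)))) → proj₁ heavyVertex , proj₁ (proj₂ heavyVertex) , refl }
  where
  open Spider (suc (suc a)) y₂ y₃
  open VertexSums π
  open FourDistinctSums a y₂ y₃ 2≤y₂ 2≤y₃ π

switchAt : ℕ → (ℕ → ℕ) → (ℕ → ℕ) → ℕ → ℕ
switchAt zero    f g t       = g t
switchAt (suc n) f g zero    = f zero
switchAt (suc n) f g (suc t) = switchAt n (f ∘ suc) g t

switchAt-< : ∀ n f g {t} → t < n → switchAt n f g t ≡ f t
switchAt-< (suc n) f g {zero}  _         = refl
switchAt-< (suc n) f g {suc t} (s≤s t<n) = switchAt-< n (f ∘ suc) g t<n

switchAt-+ : ∀ n f g t → switchAt n f g (n + t) ≡ g t
switchAt-+ zero    f g t = refl
switchAt-+ (suc n) f g t = switchAt-+ n (f ∘ suc) g t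

switchAt-≡ : ∀ n f g → switchAt n f g n ≡ g 0
switchAt-≡ zero    f g = refl
switchAt-≡ (suc n) f g = switchAt-≡ n (f ∘ suc) g

zigzag : ℕ → ℕ → ℕ → ℕ
zigzag x y zero          = x
zigzag x y (suc zero)    = y
zigzag x y (suc (suc t)) = zigzag (x ∸ 1) (suc y) t

zigzag-even : ∀ x y j → zigzag x y (j + j) ≡ x ∸ j
zigzag-even x y zero    = refl
zigzag-even x y (suc j) rewrite +-suc j j = trans (zigzag-even (x ∸ 1) (suc y) j) (∸-+-assoc x 1 j)

zigzag-odd : ∀ x y j → zigzag x y (suc (j + j)) ≡ y + j
zigzag-odd x y zero    = sym (+-identityʳ y)
zigzag-odd x y (suc j) rewrite +-suc j j = trans (zigzag-odd (x ∸ 1) (suc y) j) (sym (+-suc y j))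

parity : ∀ t → ∃ λ j → t ≡ j + j ⊎ t ≡ suc (j + j)
parity zero    = 0 , inj₁ refl
parity (suc t) with parity t
... | j , inj₁ refl = j , inj₂ refl
... | j , inj₂ refl = suc j , inj₁ (cong suc (sym (+-suc j j)))

double-mono-≤ : ∀ {j n} → j ≤ n → j + j ≤ n + n
double-mono-≤ j≤n = +-mono-≤ j≤n j≤n

double-mono-< : ∀ {j n} → j < n → suc (j + j) < n + n
double-mono-< {j} {n} j<n = subst (_≤ n + n) (cong suc (+-suc j j)) (+-mono-≤ j<n j<n)

double-cancel-≤ : ∀ {j n} → j + j ≤ n + n → j ≤ n
double-cancel-≤ 2j≤2n = ≮⇒≥ (λ n<j → <⇒≱ (+-mono-< n<j n<j) 2j≤2n)

double-cancel-< : ∀ {j n} → suc (j + j) ≤ n + n → j < n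
double-cancel-< 1+2j≤2n = ≰⇒> (λ n≤j → <⇒≱ 1+2j≤2n (double-mono-≤ n≤j))

≤-by : ∀ {x y} d → x + d ≡ y → x ≤ y
≤-by {x} d refl = m≤m+n x d

[n+c]∸[n∸j]≡c+j : ∀ {n} c {j} → j ≤ n → (n + c) ∸ (n ∸ j) ≡ c + j
[n+c]∸[n∸j]≡c+j {n} c {j} j≤n =
  trans (cong (_∸ (n ∸ j)) (+-comm n c)) (trans (+-∸-assoc c (m∸n≤m n j)) (cong (c +_) (m∸[m∸n]≡n j≤n)))

∸+-cancel : ∀ a b {j} → j ≤ a → a ∸ j + (b + j) ≡ a + b
∸+-cancel a b {j} j≤a = begin
  a ∸ j + (b + j) ≡⟨ cong (a ∸ j +_) (+-comm b j) ⟩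
  a ∸ j + (j + b) ≡⟨ +-assoc (a ∸ j) j b ⟨
  a ∸ j + j + b   ≡⟨ cong (_+ b) (m∸n+n≡m j≤a) ⟩
  a + b           ∎

+∸-cancel : ∀ a b {j} → suc j ≤ a → suc (b + j + (a ∸ suc j)) ≡ a + b
+∸-cancel a b {j} 1+j≤a = begin
  suc (b + j) + (a ∸ suc j) ≡⟨ cong (_+ (a ∸ suc j)) (+-suc b j) ⟨
  b + suc j + (a ∸ suc j)   ≡⟨ +-assoc b (suc j) (a ∸ suc j) ⟩
  b + (suc j + (a ∸ suc j)) ≡⟨ cong (b +_) (m+[n∸m]≡n 1+j≤a) ⟩
  b + a                     ≡⟨ +-comm b a ⟩
  a + b                     ∎

module Construction (m h : ℕ) (0<m : 0 < m) (0<h : 0 < h) where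

  open Spider 5 (suc (m + m)) (suc (h + h))

  B q q₋ D : ℕ
  B  = 5 + suc (m + m)
  q  = B + suc (h + h)
  q₋ = 5 + (m + m) + suc (h + h)
  D  = m + m + m + h + h + h + 9

  leg₁Label : ℕ → ℕ
  leg₁Label 0 = m + h + 3
  leg₁Label 1 = m + h + 4
  leg₁Label 2 = m + m + h + h + 5
  leg₁Label 3 = 1
  leg₁Label _ = q₋

  leg₂Label leg₃Label : ℕ → ℕ
  leg₂Label = switchAt (m + m) (zigzag (m + m + h + 4) (h + 3)) (λ _ → q)
  leg₃Label = zigzag (h + 2) (m + m + h + 5)

  f : ℕ → ℕ
  f = switchAt 5 leg₁Label (switchAt (suc (m + m)) leg₂Label leg₃Label)

  f-leg₂-even : ∀ j → j < m → f (5 + (j + j)) ≡ (m + m + h + 4) ∸ j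
  f-leg₂-even j j<m =
    trans (switchAt-< (suc (m + m)) leg₂Label leg₃Label (≤-trans 2j<2m (n≤1+n _)))
          (trans (switchAt-< (m + m) (zigzag (m + m + h + 4) (h + 3)) (λ _ → q) 2j<2m) (zigzag-even (m + m + h + 4) (h + 3) j))
    where
    2j<2m : j + j < m + m
    2j<2m = +-mono-< j<m j<m

  f-leg₂-odd : ∀ j → j < m → f (5 + suc (j + j)) ≡ h + 3 + j
  f-leg₂-odd j j<m =
    trans (switchAt-< (suc (m + m)) leg₂Label leg₃Label (≤-trans (double-mono-< j<m) (n≤1+n _)))
          (trans (switchAt-< (m + m) (zigzag (m + m + h + 4) (h + 3)) (λ _ → q) (double-mono-< j<m))
                 (zigzag-odd (m + m + h + 4) (h + 3) j))

  f-leg₂-last : f (5 + (m + m)) ≡ q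
  f-leg₂-last =
    trans (switchAt-< (suc (m + m)) leg₂Label leg₃Label (n<1+n (m + m)))
          (switchAt-≡ (m + m) (zigzag (m + m + h + 4) (h + 3)) (λ _ → q))

  f-B : f B ≡ h + 2
  f-B = switchAt-≡ (suc (m + m)) leg₂Label leg₃Label

  f-leg₃-even : ∀ j → f (B + (j + j)) ≡ (h + 2) ∸ j
  f-leg₃-even j = trans (switchAt-+ (suc (m + m)) leg₂Label leg₃Label (j + j)) (zigzag-even (h + 2) (m + m + h + 5) j)

  f-leg₃-odd : ∀ j → f (B + suc (j + j)) ≡ m + m + h + 5 + j
  f-leg₃-odd j = trans (switchAt-+ (suc (m + m)) leg₂Label leg₃Label (suc (j + j))) (zigzag-odd (h + 2) (m + m + h + 5) j)

  f-leg₃-last : f (B + (h + h)) ≡ 2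
  f-leg₃-last = trans (f-leg₃-even h) (m+n∸m≡n h 2)

  leg₁-< : ∀ {t} → t < 5 → t < q
  leg₁-< t<5 = ≤-trans t<5 (m≤m+n 5 _)

  leg₂-< : ∀ {t} → t ≤ m + m → 5 + t < q
  leg₂-< t≤2m = +-monoʳ-< 5 (≤-trans (s≤s t≤2m) (m≤m+n (suc (m + m)) (suc (h + h))))

  leg₃-< : ∀ {t} → t ≤ h + h → B + t < q
  leg₃-< t≤2h = +-monoʳ-< B (s≤s t≤2h)

  -- Edge k classified by its leg and its position t on the leg (k = 5 + t, resp. B + t);
  -- leg₂-turn is the last odd position of the second leg, just before the edge labelled q.
  data EdgeIndex : ℕ → Set where
    leg₁      : ∀ t → t < 5 → EdgeIndex t
    leg₂-even : ∀ j → j < m → EdgeIndex (5 + (j + j))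
    leg₂-odd  : ∀ j → suc j < m → EdgeIndex (5 + suc (j + j))
    leg₂-turn : ∀ j → suc j ≡ m → EdgeIndex (5 + suc (j + j))
    leg₂-last : EdgeIndex (5 + (m + m))
    leg₃-even : ∀ j → j < h → EdgeIndex (B + (j + j))
    leg₃-odd  : ∀ j → j < h → EdgeIndex (B + suc (j + j))
    leg₃-last : EdgeIndex (B + (h + h))

  edgeIndex : ∀ k → k < q → EdgeIndex k
  edgeIndex k k<q with k <? 5
  ... | yes k<5 = leg₁ k k<5
  ... | no k≮5 with t , refl ← m≤n⇒∃[o]m+o≡n (≮⇒≥ k≮5) with t <? suc (m + m)
  ...   | yes (s≤s t≤2m) = leg₂ (parity t)
    where
    leg₂ : (∃ λ j → t ≡ j + j ⊎ t ≡ suc (j + j)) → EdgeIndex (5 + t)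
    leg₂ (j , inj₁ refl) with j <? m
    ... | yes j<m = leg₂-even j j<m
    ... | no j≮m  = subst (λ i → EdgeIndex (5 + (i + i))) (sym (≤-antisym (double-cancel-≤ t≤2m) (≮⇒≥ j≮m))) leg₂-last
    leg₂ (j , inj₂ refl) with suc j <? m
    ... | yes 1+j<m = leg₂-odd j 1+j<m
    ... | no 1+j≮m  = leg₂-turn j (≤-antisym (double-cancel-< t≤2m) (≮⇒≥ 1+j≮m))
  ...   | no t≮2m+1 with s , refl ← m≤n⇒∃[o]m+o≡n (≮⇒≥ t≮2m+1) = leg₃ (parity s)
    where
    s≤2h : s ≤ h + h
    s≤2h = ≤-pred (+-cancelˡ-< B s (suc (h + h)) k<q)
    leg₃ : (∃ λ j → s ≡ j + j ⊎ s ≡ suc (j + j)) → EdgeIndex (B + s)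
    leg₃ (j , inj₁ refl) with j <? h
    ... | yes j<h = leg₃-even j j<h
    ... | no j≮h  = subst (λ i → EdgeIndex (B + (i + i))) (sym (≤-antisym (double-cancel-≤ s≤2h) (≮⇒≥ j≮h))) leg₃-last
    leg₃ (j , inj₂ refl) = leg₃-odd j (double-cancel-< s≤2h)

  m≤X₂ : m ≤ m + m + h + 4
  m≤X₂ = ≤-by (m + h + 4) (solve (m ∷ h ∷ []))

  ≤q : ∀ {x} d → x + d ≡ 5 + suc (m + m) + suc (h + h) → x ≤ q
  ≤q = ≤-by

  f-range : ∀ k → k < q → 0 < f k × f k ≤ q
  f-range k k<q = range (edgeIndex k k<q)
    where
    odd₂-range : ∀ {j} → j < m → 0 < h + 3 + j × h + 3 + j ≤ q
    odd₂-range {j} j<m =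
      ≤-by {1} (h + 2 + j) (solve (h ∷ j ∷ [])) ,
      ≤-trans (+-monoʳ-≤ (h + 3) (<⇒≤ j<m)) (≤q {h + 3 + m} (m + h + 4) (solve (m ∷ h ∷ [])))
    range : ∀ {k} → EdgeIndex k → 0 < f k × f k ≤ q
    range (leg₁ 0 _) = ≤-by {1} {m + h + 3} (m + h + 2) (solve (m ∷ h ∷ [])) ,
                       ≤q {m + h + 3} (m + h + 4) (solve (m ∷ h ∷ []))
    range (leg₁ 1 _) = ≤-by {1} {m + h + 4} (m + h + 3) (solve (m ∷ h ∷ [])) ,
                       ≤q {m + h + 4} (m + h + 3) (solve (m ∷ h ∷ []))
    range (leg₁ 2 _) = ≤-by {1} {m + m + h + h + 5} (m + m + h + h + 4) (solve (m ∷ h ∷ [])) ,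
                       ≤q {m + m + h + h + 5} 2 (solve (m ∷ h ∷ []))
    range (leg₁ 3 _) = s≤s z≤n , s≤s z≤n
    range (leg₁ 4 _) = s≤s z≤n , n≤1+n q₋
    range (leg₁ (suc (suc (suc (suc (suc _))))) (s≤s (s≤s (s≤s (s≤s (s≤s ()))))))
    range (leg₂-even j j<m) rewrite f-leg₂-even j j<m =
      m<n⇒0<n∸m (≤-trans j<m m≤X₂) ,
      ≤-trans (m∸n≤m (m + m + h + 4) j) (≤q {m + m + h + 4} (h + 3) (solve (m ∷ h ∷ [])))
    range (leg₂-odd j 1+j<m) rewrite f-leg₂-odd j (<-trans (n<1+n j) 1+j<m) = odd₂-range (<-trans (n<1+n j) 1+j<m)
    range (leg₂-turn j 1+j≡m) rewrite f-leg₂-odd j (≤-reflexive 1+j≡m)       = odd₂-range (≤-reflexive 1+j≡m)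
    range leg₂-last rewrite f-leg₂-last = s≤s z≤n , ≤-refl
    range (leg₃-even j j<h) rewrite f-leg₃-even j =
      m<n⇒0<n∸m (≤-trans j<h (m≤m+n h 2)) ,
      ≤-trans (m∸n≤m (h + 2) j) (≤q {h + 2} (m + m + h + 5) (solve (m ∷ h ∷ [])))
    range (leg₃-odd j j<h) rewrite f-leg₃-odd j =
      ≤-by {1} (m + m + h + 4 + j) (solve (m ∷ h ∷ j ∷ [])) ,
      ≤-trans (+-monoʳ-≤ (m + m + h + 5) (<⇒≤ j<h)) (≤q {m + m + h + 5 + h} 2 (solve (m ∷ h ∷ [])))
    range leg₃-last rewrite f-leg₃-last = s≤s z≤n , ≤-trans (s≤s (s≤s z≤n)) (m≤m+n 2 _)

  -- suc x lies in one of the bands 1 | 2…h+2 | h+3…m+h+2 | m+h+3 | m+h+4 | m+h+5…2m+h+4 |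
  -- 2m+h+5…2m+2h+4 | q-2 | q-1 | q, each covered by one family of labels.
  f-onto : ∀ x → x < q → ∃ λ k → k < q × f k ≡ suc x
  f-onto zero _ = 3 , leg₁-< (s≤s (s≤s (s≤s (s≤s z≤n)))) , refl
  f-onto (suc x) x<q with x ≤? h
  ... | yes x≤h = B + (h ∸ x + (h ∸ x)) , leg₃-< (double-mono-≤ (m∸n≤m h x)) ,
                  trans (f-leg₃-even (h ∸ x)) ([n+c]∸[n∸j]≡c+j 2 x≤h)
  ... | no x≰h with i , refl ← m≤n⇒∃[o]m+o≡n (≰⇒> x≰h) with i <? m
  ...   | yes i<m = 5 + suc (i + i) , leg₂-< (<⇒≤ (double-mono-< i<m)) ,
                    trans (f-leg₂-odd i i<m) (solve (h ∷ i ∷ []))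
  ...   | no i≮m with i′ , refl ← m≤n⇒∃[o]m+o≡n (≮⇒≥ i≮m) with i′
  ...     | 0 = 0 , leg₁-< (s≤s z≤n) , trans {j = m + h + 3} refl (solve (m ∷ h ∷ []))
  ...     | 1 = 1 , leg₁-< (s≤s (s≤s z≤n)) , trans {j = m + h + 4} refl (solve (m ∷ h ∷ []))
  ...     | suc (suc j) with j <? m
  ...       | yes j<m = 5 + (m ∸ suc j + (m ∸ suc j)) , leg₂-< (double-mono-≤ (m∸n≤m m (suc j))) ,
                        trans (f-leg₂-even (m ∸ suc j) (∸-monoʳ-< {m} {suc j} {0} (s≤s z≤n) j<m))
                              (trans (cong (_∸ (m ∸ suc j)) {m + m + h + 4} {m + (m + h + 4)} (solve (m ∷ h ∷ [])))
                                     (trans ([n+c]∸[n∸j]≡c+j (m + h + 4) j<m) (solve (m ∷ h ∷ j ∷ []))))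
  ...       | no j≮m with j′ , refl ← m≤n⇒∃[o]m+o≡n (≮⇒≥ j≮m) with j′ <? h
  ...         | yes j′<h = B + suc (j′ + j′) , leg₃-< (<⇒≤ (double-mono-< j′<h)) ,
                           trans (f-leg₃-odd j′) (solve (m ∷ h ∷ j′ ∷ []))
  ...         | no j′≮h with r , refl ← m≤n⇒∃[o]m+o≡n (≮⇒≥ j′≮h) with r
  ...           | 0 = 2 , leg₁-< (s≤s (s≤s (s≤s z≤n))) , trans {j = m + m + h + h + 5} refl (solve (m ∷ h ∷ []))
  ...           | 1 = 4 , leg₁-< ≤-refl , trans {j = 5 + (m + m) + suc (h + h)} refl (solve (m ∷ h ∷ []))
  ...           | 2 = 5 + (m + m) , leg₂-< ≤-refl , trans {j = 5 + suc (m + m) + suc (h + h)} f-leg₂-last (solve (m ∷ h ∷ []))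
  ...           | suc (suc (suc r′)) =
    ⊥-elim (<⇒≱ x<q (≤-by {5 + suc (m + m) + suc (h + h)} {suc (suc h + (m + suc (suc (m + (h + suc (suc (suc r′)))))))}
                           r′ (solve (m ∷ h ∷ r′ ∷ []))))

  ¬LegStart-leg₁ : ∀ {t} → 0 < t → t < 5 → ¬ LegStart t
  ¬LegStart-leg₁ 0<t t<5 = ¬LegStart 0<t (<⇒≢ t<5) (<⇒≢ (≤-trans t<5 (m≤m+n 5 _)))

  ¬LegStart-leg₂ : ∀ {t} → 0 < t → t ≤ m + m → ¬ LegStart (5 + t)
  ¬LegStart-leg₂ {t} 0<t t≤2m =
    ¬LegStart (s≤s z≤n) (>⇒≢ (m<m+n 5 0<t)) (<⇒≢ (+-monoʳ-< 5 (s≤s t≤2m)))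

  ¬LegStart-leg₃ : ∀ t → ¬ LegStart (suc (B + t))
  ¬LegStart-leg₃ t = ¬LegStart (s≤s z≤n) (λ ()) (≢-sym (m≢1+m+n B))

  -- opaque: unfolding the constructed bijection in later goals is prohibitively slow
  opaque
    labeling : ∃ λ π → ∀ k → k < q → edgeLabel S π k ≡ f k
    labeling = labeling-from S size-Sp f f-range f-onto

  π : Labeling S
  π = proj₁ labeling

  open VertexSums π

  ℓ≡f : ∀ {k} → k < q → ℓ k ≡ f k
  ℓ≡f {k} = proj₂ labeling k

  vsum-inner-f : ∀ k → ¬ LegStart (suc k) → suc k < q → vsum S π (suc k) ≡ f k + f (suc k)
  vsum-inner-f k ¬s 1+k<q = trans (vsum-inner k ¬s) (cong₂ _+_ (ℓ≡f (<-trans (n<1+n k) 1+k<q)) (ℓ≡f 1+k<q))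

  childColour : ∀ {k} → EdgeIndex k → ℕ
  childColour (leg₁ 0 _)      = q
  childColour (leg₁ 1 _)      = D
  childColour (leg₁ 2 _)      = q₋
  childColour (leg₁ 3 _)      = q
  childColour (leg₁ _ _)      = q₋
  childColour (leg₂-even _ _) = q
  childColour (leg₂-odd _ _)  = q₋
  childColour (leg₂-turn _ _) = D
  childColour leg₂-last       = q
  childColour (leg₃-even _ _) = q
  childColour (leg₃-odd _ _)  = q₋
  childColour leg₃-last       = 2

  vsum-leg₁ : ∀ t (t<5 : t < 5) → vsum S π (suc t) ≡ childColour (leg₁ t t<5)
  vsum-leg₁ 0 _ = begin
    vsum S π 1                      ≡⟨ vsum-inner-f 0 (¬LegStart-leg₁ (s≤s z≤n) 2≤5) (leg₁-< 2≤5) ⟩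
    m + h + 3 + (m + h + 4)         ≡⟨ solve (m ∷ h ∷ []) ⟩
    5 + suc (m + m) + suc (h + h)   ∎
    where
    2≤5 : 2 ≤ 5
    2≤5 = s≤s (s≤s z≤n)
  vsum-leg₁ 1 _ = begin
    vsum S π 2                      ≡⟨ vsum-inner-f 1 (¬LegStart-leg₁ (s≤s z≤n) 3≤5) (leg₁-< 3≤5) ⟩
    m + h + 4 + (m + m + h + h + 5) ≡⟨ solve (m ∷ h ∷ []) ⟩
    m + m + m + h + h + h + 9       ∎
    where
    3≤5 : 3 ≤ 5
    3≤5 = s≤s (s≤s (s≤s z≤n))
  vsum-leg₁ 2 _ = begin
    vsum S π 3                      ≡⟨ vsum-inner-f 2 (¬LegStart-leg₁ (s≤s z≤n) 4≤5) (leg₁-< 4≤5) ⟩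
    m + m + h + h + 5 + 1           ≡⟨ solve (m ∷ h ∷ []) ⟩
    5 + (m + m) + suc (h + h)       ∎
    where
    4≤5 : 4 ≤ 5
    4≤5 = s≤s (s≤s (s≤s (s≤s z≤n)))
  vsum-leg₁ 3 _ = vsum-inner-f 3 (¬LegStart-leg₁ (s≤s z≤n) ≤-refl) (leg₁-< ≤-refl)
  vsum-leg₁ 4 _ = trans (vsum-legEnd 4 (inj₂ (inj₁ refl))) (ℓ≡f (leg₁-< ≤-refl))
  vsum-leg₁ (suc (suc (suc (suc (suc _))))) (s≤s (s≤s (s≤s (s≤s (s≤s ())))))

  vsum-leg₂-even : ∀ j → j < m → vsum S π (5 + suc (j + j)) ≡ q
  vsum-leg₂-even j j<m = begin
    vsum S π (5 + suc (j + j))            ≡⟨ vsum-inner-f (5 + (j + j)) (¬LegStart-leg₂ (s≤s z≤n) 1+2j≤2m) (leg₂-< 1+2j≤2m) ⟩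
    f (5 + (j + j)) + f (5 + suc (j + j)) ≡⟨ cong₂ _+_ (f-leg₂-even j j<m) (f-leg₂-odd j j<m) ⟩
    m + m + h + 4 ∸ j + (h + 3 + j)       ≡⟨ ∸+-cancel (m + m + h + 4) (h + 3) (≤-trans (<⇒≤ j<m) m≤X₂) ⟩
    m + m + h + 4 + (h + 3)               ≡⟨ solve (m ∷ h ∷ []) ⟩
    5 + suc (m + m) + suc (h + h)         ∎
    where
    1+2j≤2m : suc (j + j) ≤ m + m
    1+2j≤2m = <⇒≤ (double-mono-< j<m)

  vsum-leg₂-odd : ∀ j → suc j < m → suc (vsum S π (5 + suc (suc (j + j)))) ≡ q
  vsum-leg₂-odd j 1+j<m = begin
    suc (vsum S π (5 + suc (suc (j + j))))
      ≡⟨ cong suc (vsum-inner-f (5 + suc (j + j)) (¬LegStart-leg₂ (s≤s z≤n) (double-mono-< j<m)) (leg₂-< (double-mono-< j<m))) ⟩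
    suc (f (5 + suc (j + j)) + f (5 + suc (suc (j + j))))
      ≡⟨ cong suc (cong₂ _+_ (f-leg₂-odd j j<m) (trans (cong (λ i → f (5 + suc i)) (sym (+-suc j j))) (f-leg₂-even (suc j) 1+j<m))) ⟩
    suc (h + 3 + j + (m + m + h + 4 ∸ suc j))
      ≡⟨ +∸-cancel (m + m + h + 4) (h + 3) (≤-trans (<⇒≤ 1+j<m) m≤X₂) ⟩
    m + m + h + 4 + (h + 3)
      ≡⟨ solve (m ∷ h ∷ []) ⟩
    suc (5 + (m + m) + suc (h + h)) ∎
    where
    j<m : j < m
    j<m = <-trans (n<1+n j) 1+j<m

  vsum-leg₂-turn : ∀ j → suc j ≡ m → vsum S π (5 + suc (suc (j + j))) ≡ D
  vsum-leg₂-turn j 1+j≡m = begin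
    vsum S π (5 + suc (suc (j + j)))
      ≡⟨ vsum-inner-f (5 + suc (j + j)) (¬LegStart-leg₂ (s≤s z≤n) (double-mono-< j<m)) (leg₂-< (double-mono-< j<m)) ⟩
    f (5 + suc (j + j)) + f (5 + suc (suc (j + j)))
      ≡⟨ cong₂ _+_ (f-leg₂-odd j j<m) (trans (cong f 2+2j≡2m) f-leg₂-last) ⟩
    h + 3 + j + q
      ≡⟨ subst (λ n → h + 3 + j + (5 + suc (n + n) + suc (h + h)) ≡ n + n + n + h + h + h + 9) 1+j≡m turn-sum ⟩
    D ∎
    where
    j<m : j < m
    j<m = ≤-reflexive 1+j≡m
    2+2j≡2m : 5 + suc (suc (j + j)) ≡ 5 + (m + m)
    2+2j≡2m = cong (5 +_) (trans (cong suc (sym (+-suc j j))) (cong (λ n → n + n) 1+j≡m))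
    turn-sum : h + 3 + j + (5 + suc (suc j + suc j) + suc (h + h)) ≡ suc j + suc j + suc j + h + h + h + 9
    turn-sum = solve (h ∷ j ∷ [])

  vsum-leg₃-even : ∀ j → j < h → vsum S π (suc (B + (j + j))) ≡ q
  vsum-leg₃-even j j<h = begin
    vsum S π (suc (B + (j + j)))
      ≡⟨ vsum-inner-f (B + (j + j)) (¬LegStart-leg₃ (j + j)) (subst (_< q) (+-suc B (j + j)) (leg₃-< (<⇒≤ (double-mono-< j<h)))) ⟩
    f (B + (j + j)) + f (suc (B + (j + j)))
      ≡⟨ cong₂ _+_ (f-leg₃-even j) (trans (cong f (sym (+-suc B (j + j)))) (f-leg₃-odd j)) ⟩
    h + 2 ∸ j + (m + m + h + 5 + j)
      ≡⟨ ∸+-cancel (h + 2) (m + m + h + 5) (≤-trans (<⇒≤ j<h) (m≤m+n h 2)) ⟩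
    h + 2 + (m + m + h + 5)
      ≡⟨ solve (m ∷ h ∷ []) ⟩
    5 + suc (m + m) + suc (h + h) ∎

  vsum-leg₃-odd : ∀ j → j < h → suc (vsum S π (suc (B + suc (j + j)))) ≡ q
  vsum-leg₃-odd j j<h = begin
    suc (vsum S π (suc (B + suc (j + j))))
      ≡⟨ cong suc (vsum-inner-f (B + suc (j + j)) (¬LegStart-leg₃ (suc (j + j))) (subst (_< q) (sym idx) (leg₃-< (double-mono-≤ j<h)))) ⟩
    suc (f (B + suc (j + j)) + f (suc (B + suc (j + j))))
      ≡⟨ cong suc (cong₂ _+_ (f-leg₃-odd j) (trans (cong f idx) (f-leg₃-even (suc j)))) ⟩
    suc (m + m + h + 5 + j + (h + 2 ∸ suc j))
      ≡⟨ +∸-cancel (h + 2) (m + m + h + 5) (≤-trans j<h (m≤m+n h 2)) ⟩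
    h + 2 + (m + m + h + 5)
      ≡⟨ solve (m ∷ h ∷ []) ⟩
    suc (5 + (m + m) + suc (h + h)) ∎
    where
    idx : suc (B + suc (j + j)) ≡ B + (suc j + suc j)
    idx = trans (sym (+-suc B (suc (j + j)))) (cong (λ i → B + suc i) (sym (+-suc j j)))

  vsum-child : ∀ {k} (i : EdgeIndex k) → vsum S π (suc k) ≡ childColour i
  vsum-child (leg₁ t t<5)        = vsum-leg₁ t t<5
  vsum-child (leg₂-even j j<m)   = vsum-leg₂-even j j<m
  vsum-child (leg₂-odd j 1+j<m)  = suc-injective (vsum-leg₂-odd j 1+j<m)
  vsum-child (leg₂-turn j 1+j≡m) = vsum-leg₂-turn j 1+j≡m
  vsum-child leg₂-last           =
    trans (vsum-legEnd (5 + (m + m)) (inj₂ (inj₂ refl))) (trans (ℓ≡f (leg₂-< ≤-refl)) f-leg₂-last)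
  vsum-child (leg₃-even j j<h)   = vsum-leg₃-even j j<h
  vsum-child (leg₃-odd j j<h)    = suc-injective (vsum-leg₃-odd j j<h)
  vsum-child leg₃-last           =
    trans (vsum-last (B + (h + h)) (trans size-Sp (+-suc B (h + h)))) (trans (ℓ≡f (leg₃-< ≤-refl)) f-leg₃-last)

  vsum-root : vsum S π 0 ≡ D
  vsum-root = begin
    vsum S π 0
      ≡⟨ vsum-core (s≤s z≤n) (s≤s z≤n) ⟩
    ℓ 0 + ℓ 5 + ℓ B
      ≡⟨ cong₂ _+_ (cong₂ _+_ (ℓ≡f (leg₁-< (s≤s z≤n))) (ℓ≡f (leg₂-< z≤n))) (ℓ≡f (m<m+n B (s≤s z≤n))) ⟩
    f 0 + f 5 + f B
      ≡⟨ cong₂ _+_ (cong (f 0 +_) (f-leg₂-even 0 0<m)) f-B ⟩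
    m + h + 3 + (m + m + h + 4) + (h + 2)
      ≡⟨ solve (m ∷ h ∷ []) ⟩
    m + m + m + h + h + h + 9 ∎

  parentColour : ∀ {k} → EdgeIndex k → ℕ
  parentColour (leg₁ 0 _)            = D
  parentColour (leg₁ (suc t) 1+t<5)  = childColour (leg₁ t (<-trans (n<1+n t) 1+t<5))
  parentColour (leg₂-even 0 _)       = D
  parentColour (leg₂-even (suc _) _) = q₋
  parentColour (leg₂-odd _ _)        = q
  parentColour (leg₂-turn _ _)       = q
  parentColour leg₂-last             = D
  parentColour (leg₃-even 0 _)       = D
  parentColour (leg₃-even (suc _) _) = q₋
  parentColour (leg₃-odd _ _)        = q
  parentColour leg₃-last             = q₋

  vsum-parent-inner : ∀ {k k′} → k ≡ suc k′ → ¬ LegStart (suc k′) → (i : EdgeIndex k′) →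
                      vsum S π (parent k) ≡ childColour i
  vsum-parent-inner refl ¬s i = trans (cong (vsum S π) (parent-inner ¬s)) (vsum-child i)

  vsum-parent : ∀ {k} (i : EdgeIndex k) → vsum S π (parent k) ≡ parentColour i
  vsum-parent (leg₁ 0 _) = trans (cong (vsum S π) (parent-start (inj₁ refl))) vsum-root
  vsum-parent (leg₁ (suc t) 1+t<5) =
    vsum-parent-inner refl (¬LegStart-leg₁ (s≤s z≤n) 1+t<5) (leg₁ t (<-trans (n<1+n t) 1+t<5))
  vsum-parent (leg₂-even 0 _) = trans (cong (vsum S π) (parent-start (inj₂ (inj₁ refl)))) vsum-root
  vsum-parent (leg₂-even (suc j) 1+j<m) =
    vsum-parent-inner (cong (λ i → 5 + suc i) (+-suc j j))
                      (¬LegStart-leg₂ (s≤s z≤n) (double-mono-< (<-trans (n<1+n j) 1+j<m))) (leg₂-odd j 1+j<m)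
  vsum-parent (leg₂-odd j 1+j<m) =
    vsum-parent-inner refl (¬LegStart-leg₂ (s≤s z≤n) (<⇒≤ (double-mono-< j<m))) (leg₂-even j j<m)
    where
    j<m : j < m
    j<m = <-trans (n<1+n j) 1+j<m
  vsum-parent (leg₂-turn j 1+j≡m) =
    vsum-parent-inner refl (¬LegStart-leg₂ (s≤s z≤n) (<⇒≤ (double-mono-< j<m))) (leg₂-even j j<m)
    where
    j<m : j < m
    j<m = ≤-reflexive 1+j≡m
  vsum-parent leg₂-last =
    vsum-parent-inner (cong (5 +_) (sym (trans (cong suc (sym (+-suc j j))) (cong (λ n → n + n) 1+j≡m))))
                      (¬LegStart-leg₂ (s≤s z≤n) (double-mono-< (≤-reflexive 1+j≡m))) (leg₂-turn j 1+j≡m)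
    where
    j = m ∸ 1
    1+j≡m : suc j ≡ m
    1+j≡m = suc[n∸1]≡n 0<m
  vsum-parent (leg₃-even 0 _) = trans (cong (vsum S π) (parent-start (inj₂ (inj₂ (+-identityʳ B))))) vsum-root
  vsum-parent (leg₃-even (suc j) 1+j<h) =
    vsum-parent-inner (trans (cong (λ i → B + suc i) (+-suc j j)) (+-suc B (suc (j + j))))
                      (¬LegStart-leg₃ (suc (j + j))) (leg₃-odd j (<-trans (n<1+n j) 1+j<h))
  vsum-parent (leg₃-odd j j<h) = vsum-parent-inner (+-suc B (j + j)) (¬LegStart-leg₃ (j + j)) (leg₃-even j j<h)
  vsum-parent leg₃-last =
    vsum-parent-inner (trans (cong (B +_) (sym (trans (cong suc (sym (+-suc j j))) (cong (λ n → n + n) 1+j≡h))))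
                             (+-suc B (suc (j + j))))
                      (¬LegStart-leg₃ (suc (j + j))) (leg₃-odd j (≤-reflexive 1+j≡h))
    where
    j = h ∸ 1
    1+j≡h : suc j ≡ h
    1+j≡h = suc[n∸1]≡n 0<h

  q<D : q < D
  q<D = ≤-by {suc (5 + suc (m + m) + suc (h + h))} {m + m + m + h + h + h + 9} (m + h + 1) (solve (m ∷ h ∷ []))

  2<q₋ : 2 < q₋
  2<q₋ = ≤-trans (s≤s (s≤s (s≤s z≤n))) (m≤m+n 5 _)

  colours-differ : ∀ {k} (i : EdgeIndex k) → parentColour i ≢ childColour i
  colours-differ (leg₁ 0 _)            = >⇒≢ q<D
  colours-differ (leg₁ 1 _)            = <⇒≢ q<D
  colours-differ (leg₁ 2 _)            = >⇒≢ (<-trans (n<1+n q₋) q<D)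
  colours-differ (leg₁ 3 _)            = <⇒≢ (n<1+n q₋)
  colours-differ (leg₁ 4 _)            = >⇒≢ (n<1+n q₋)
  colours-differ (leg₁ (suc (suc (suc (suc (suc _))))) (s≤s (s≤s (s≤s (s≤s (s≤s ()))))))
  colours-differ (leg₂-even 0 _)       = >⇒≢ q<D
  colours-differ (leg₂-even (suc _) _) = <⇒≢ (n<1+n q₋)
  colours-differ (leg₂-odd _ _)        = >⇒≢ (n<1+n q₋)
  colours-differ (leg₂-turn _ _)       = <⇒≢ q<D
  colours-differ leg₂-last             = >⇒≢ q<D
  colours-differ (leg₃-even 0 _)       = >⇒≢ q<D
  colours-differ (leg₃-even (suc _) _) = <⇒≢ (n<1+n q₋)
  colours-differ (leg₃-odd _ _)        = >⇒≢ (n<1+n q₋)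
  colours-differ leg₃-last             = >⇒≢ 2<q₋

  colours : List ℕ
  colours = q ∷ q₋ ∷ D ∷ 2 ∷ []

  childColour∈ : ∀ {k} (i : EdgeIndex k) → childColour i ∈ colours
  childColour∈ (leg₁ 0 _)      = here refl
  childColour∈ (leg₁ 1 _)      = there (there (here refl))
  childColour∈ (leg₁ 2 _)      = there (here refl)
  childColour∈ (leg₁ 3 _)      = here refl
  childColour∈ (leg₁ 4 _)      = there (here refl)
  childColour∈ (leg₁ (suc (suc (suc (suc (suc _))))) (s≤s (s≤s (s≤s (s≤s (s≤s ()))))))
  childColour∈ (leg₂-even _ _) = here refl
  childColour∈ (leg₂-odd _ _)  = there (here refl)
  childColour∈ (leg₂-turn _ _) = there (there (here refl))
  childColour∈ leg₂-last       = here refl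
  childColour∈ (leg₃-even _ _) = here refl
  childColour∈ (leg₃-odd _ _)  = there (here refl)
  childColour∈ leg₃-last       = there (there (there (here refl)))

  witness : ∃ λ π → LocalAntimagic S π × numColors S π ≤ 4
  witness = π , localAntimagic adjacent , numColors-≤ S π colours coloured
    where
    adjacent : ∀ k → k < Q → vsum S π (parent k) ≢ vsum S π (suc k)
    adjacent k k<Q with i ← edgeIndex k (subst (k <_) size-Sp k<Q) =
      λ eq → colours-differ i (trans (sym (vsum-parent i)) (trans eq (vsum-child i)))
    coloured : ∀ v → v < nV S → vsum S π v ∈ colours
    coloured zero    _         = subst (_∈ colours) (sym vsum-root) (there (there (here refl)))
    coloured (suc k) (s≤s k<q) = subst (_∈ colours) (sym (vsum-child (edgeIndex k k<q))) (childColour∈ (edgeIndex k k<q))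

1+n+n≡2*n+1 : ∀ n → suc (n + n) ≡ 2 * n + 1
1+n+n≡2*n+1 = solve-∀

2≤1+n+n : ∀ {n} → 1 ≤ n → 2 ≤ suc (n + n)
2≤1+n+n {n} 1≤n = s≤s (≤-trans 1≤n (m≤m+n n n))

theorem5p9 : (m h : ℕ) → 1 ≤ m → 3 ≤ h → ChiLa (Sp 5 (2 * m + 1) (2 * h + 1)) 4
-- the hypothesis 3 ≤ h is only used through 1 ≤ h
theorem5p9 m h 1≤m 3≤h =
  subst (λ G → ChiLa G 4) (cong₂ (Sp 5) (1+n+n≡2*n+1 m) (1+n+n≡2*n+1 h))
    (ChiLa-intro {Sp 5 (suc (m + m)) (suc (h + h))} (Construction.witness m h 1≤m 1≤h)
                 (numColors-Sp≥4 {5} (s≤s (s≤s z≤n)) (2≤1+n+n 1≤m) (2≤1+n+n 1≤h)))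
  where
  1≤h : 1 ≤ h
  1≤h = ≤-trans (s≤s z≤n) 3≤h
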